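{- Let $m_1,\ldots,m_n$ be nonnegative integers and let $D(x_1,\ldots,x_n)=\det\big(x_j^{m_i}\big)_{1\leqslant i,j\leqslant n}$. Then, as an identity of rational functions in $x$, $$D^*(x-n+1,x-n+2,\ldots,x-1,x)=\prod_{1\leqslant i<j\leqslant n}(m_j-m_i)\times\prod_{i=1}^n\frac{(x)_{m_i}}{(x)_{i-1}},$$ where the $i$th argument of $D^*$ is $x-n+i$.
   Context: Falling factorials: $(x)_0=1$ and $(x)_r=x(x-1)\cdots(x-r+1)$ for $r\geqslant 1$. For a polynomial $Q=\sum c_{j_1,\ldots,j_n}x_1^{j_1}\cdots x_n^{j_n}$, define $Q^*(x_1,\ldots,x_n)=\sum c_{j_1,\ldots,j_n}(x_1)_{j_1}\cdots(x_n)_{j_n}$. -}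

module Defs where

open import Data.Nat as ℕ using (ℕ; zero; suc)
open import Data.Integer using (ℤ; +_; _+_; _*_; -_; _-_)
open import Data.Fin as Fin using (Fin; zero; suc; punchIn; toℕ)
open import Data.List using (List; []; _∷_; _++_; map; concatMap)
open import Data.Product using (_×_; _,_)
open import Data.Bool using (if_then_else_)
open import Relation.Nullary using (does)
open import Function using (_∘_)

ff : ℤ → ℕ → ℤ
ff x zero = + 1
ff x (suc r) = x * ff (x - + 1) r

prodFin : (n : ℕ) → (Fin n → ℤ) → ℤ
prodFin zero f = + 1
prodFin (suc n) f = f zero * prodFin n (f ∘ suc)

-- Polynomials in x_1..x_n with integer coefficients, as (unnormalised)
-- lists of monomials (coefficient , exponent vector).
Poly : ℕ → Set
Poly n = List (ℤ × (Fin n → ℕ))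

module _ {n : ℕ} where
  pzero : Poly n
  pzero = []

  pone : Poly n
  pone = (+ 1 , λ _ → 0) ∷ []

  padd : Poly n → Poly n → Poly n
  padd = _++_

  pneg : Poly n → Poly n
  pneg = map (λ { (c , e) → (- c , e) })

  pmul : Poly n → Poly n → Poly n
  pmul p q = concatMap (λ { (c , e) → map (λ { (d , f) → (c * d , λ j → e j ℕ.+ f j) }) q }) p

  xpow : Fin n → ℕ → Poly n
  xpow j k = (+ 1 , λ i → if does (i Fin.≟ j) then k else 0) ∷ []

-- Q* evaluated at y : replace each monomial x_1^{j_1}...x_n^{j_n}
-- by (y_1)_{j_1} ... (y_n)_{j_n}  (linear extension).
star : {n : ℕ} → Poly n → (Fin n → ℤ) → ℤ
star {n} [] y = + 0
star {n} ((c , e) ∷ p) y = c * prodFin n (λ j → ff (y j) (e j)) + star p y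

module Det {A : Set} (1# : A) (_⊕_ _⊗_ : A → A → A) (⊖_ : A → A) where
  -- altSum n f = f 0 - f 1 + f 2 - ... ± f n
  altSum : (n : ℕ) → (Fin (suc n) → A) → A
  altSum zero f = f zero
  altSum (suc n) f = f zero ⊕ (⊖ altSum n (f ∘ suc))

  det : (n : ℕ) → (Fin n → Fin n → A) → A
  det zero M = 1#
  det (suc n) M = altSum n (λ j → M zero j ⊗ det n (λ r c → M (suc r) (punchIn j c)))

D : (n : ℕ) → (Fin n → ℕ) → Poly n
D n m = Det.det pone padd pmul pneg n (λ i j → xpow j (m i))

vdm : (n : ℕ) → (Fin n → ℕ) → ℤ
vdm n m = prodFin n (λ j → prodFin n (λ i →
  if does (toℕ i ℕ.<? toℕ j) then (+ m j - + m i) else + 1))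

{-# OPTIONS --safe #-}
-- D*(y) is the determinant of the matrix ((y_j)_{m_i}): star is multiplicative on each term of
-- the Laplace expansion because distinct columns carry distinct variables.  With
-- y_j = x - (n - 1 - j) and (x)_{a+b} = (x)_a (x - a)_b = (x)_b (x - b)_a, scaling column j by
-- (x)_{n-1-j} (the factors of ∏_i (x)_{i-1} in reverse order) turns the matrix into
-- ((x)_{m_i} · (x - m_i)_{n-1-j}).  What remains is the falling-factorial Vandermonde
-- determinant det((z_i)_{n-1-j}) = ∏_{i<j} (z_i - z_j) at z_i = x - m_i, proved by column
-- reduction as for the ordinary one.
module Submission where

open import Defs
open import Data.Nat using (ℕ; suc)
open import Data.Integer using (ℤ; +_; _+_; _*_; _-_)
open import Data.Fin using (Fin; toℕ)
open import Relation.Binary.PropositionalEquality using (_≡_)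

open import Data.Bool using (if_then_else_)
open import Data.Empty using (⊥-elim)
open import Data.Fin using (zero; suc; inject₁; fromℕ; fromℕ<; punchIn; punchOut; _≟_)
import Data.Fin.Properties as Finₚ
open import Data.Integer using (-_; -1ℤ; _^_)
open import Data.Integer.Properties
  using ( +-identityˡ; +-identityʳ; +-assoc; +-inverseʳ
        ; *-identityˡ; *-identityʳ; *-zeroʳ; *-comm; *-commutativeSemigroup)
open import Algebra.Properties.CommutativeSemigroup *-commutativeSemigroup
  using (interchange; x∙yz≈y∙xz; x∙yz≈xy∙z)
open import Data.Integer.Tactic.RingSolver using (solve-∀)
open import Data.List using ([]; _∷_)
open import Data.List.Relation.Unary.All as All using (All; []; _∷_)
open import Data.List.Relation.Unary.All.Properties using (map⁺; ++⁺; concat⁺)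
open import Data.Nat as ℕ using (zero; _∸_; _<_; _≤_; _<?_)
import Data.Nat.Properties as ℕₚ
open import Data.Product using (Σ-syntax; _×_; _,_)
open import Data.Sum using (_⊎_; inj₁; inj₂)
open import Data.Vec.Functional using (updateAt)
open import Data.Vec.Functional.Properties using (updateAt-updates; updateAt-minimal)
open import Function using (_∘_; id)
open import Function.Definitions using (Injective)
open import Relation.Binary.PropositionalEquality
  using (_≢_; refl; sym; trans; cong; cong₂; subst; module ≡-Reasoning)
open import Relation.Nullary using (does; yes; no; ¬_)
open import Relation.Nullary.Decidable using (dec-true; dec-false)

open Det (+ 1) _+_ _*_ -_ using (det; altSum)
open ≡-Reasoning

prodFin-cong : ∀ n {f g : Fin n → ℤ} → (∀ i → f i ≡ g i) → prodFin n f ≡ prodFin n g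
prodFin-cong zero    f≗g = refl
prodFin-cong (suc n) f≗g = cong₂ _*_ (f≗g zero) (prodFin-cong n (f≗g ∘ suc))

prodFin-1 : ∀ n → prodFin n (λ _ → + 1) ≡ + 1
prodFin-1 zero    = refl
prodFin-1 (suc n) = cong (+ 1 *_) (prodFin-1 n)

prodFin-* : ∀ n (f g : Fin n → ℤ) → prodFin n (λ i → f i * g i) ≡ prodFin n f * prodFin n g
prodFin-* zero    f g = refl
prodFin-* (suc n) f g =
  trans (cong (f zero * g zero *_) (prodFin-* n (f ∘ suc) (g ∘ suc)))
        (interchange (f zero) (g zero) _ _)

prodFin-concentrated : ∀ n (g : Fin n → ℤ) j → (∀ i → i ≢ j → g i ≡ + 1) → prodFin n g ≡ g j
prodFin-concentrated (suc n) g zero    g≡1 = begin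
  g zero * prodFin n (g ∘ suc)    ≡⟨ cong (g zero *_) (prodFin-cong n (λ i → g≡1 (suc i) λ ())) ⟩
  g zero * prodFin n (λ _ → + 1)  ≡⟨ cong (g zero *_) (prodFin-1 n) ⟩
  g zero * + 1                    ≡⟨ *-identityʳ (g zero) ⟩
  g zero                          ∎
prodFin-concentrated (suc n) g (suc j) g≡1 = begin
  g zero * prodFin n (g ∘ suc)
    ≡⟨ cong₂ _*_ (g≡1 zero λ ()) (prodFin-concentrated n (g ∘ suc) j g∘suc≡1) ⟩
  + 1 * g (suc j)
    ≡⟨ *-identityˡ (g (suc j)) ⟩
  g (suc j)
    ∎
  where
  g∘suc≡1 : ∀ i → i ≢ j → g (suc i) ≡ + 1
  g∘suc≡1 i i≢j = g≡1 (suc i) (i≢j ∘ Finₚ.suc-injective)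

prodFin-punchIn : ∀ n (g : Fin (suc n) → ℤ) j → g j * prodFin n (g ∘ punchIn j) ≡ prodFin (suc n) g
prodFin-punchIn n       g zero    = refl
prodFin-punchIn (suc n) g (suc j) =
  trans (x∙yz≈y∙xz (g (suc j)) (g zero) _) (cong (g zero *_) (prodFin-punchIn n (g ∘ suc) j))

prodFin-last : ∀ n (g : Fin (suc n) → ℤ) → prodFin (suc n) g ≡ prodFin n (g ∘ inject₁) * g (fromℕ n)
prodFin-last zero    g = *-comm (g zero) (+ 1)
prodFin-last (suc n) g =
  trans (cong (g zero *_) (prodFin-last n (g ∘ suc))) (x∙yz≈xy∙z (g zero) _ _)

prodFin-reverse : ∀ n (f : ℕ → ℤ) → prodFin n (f ∘ toℕ) ≡ prodFin n (λ i → f (n ∸ suc (toℕ i)))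
prodFin-reverse zero    f = refl
prodFin-reverse (suc n) f = begin
  prodFin (suc n) (f ∘ toℕ)
    ≡⟨ prodFin-last n (f ∘ toℕ) ⟩
  prodFin n (f ∘ toℕ ∘ inject₁) * f (toℕ (fromℕ n))
    ≡⟨ cong₂ _*_ (prodFin-cong n (cong f ∘ Finₚ.toℕ-inject₁)) (cong f (Finₚ.toℕ-fromℕ n)) ⟩
  prodFin n (f ∘ toℕ) * f n
    ≡⟨ cong (_* f n) (prodFin-reverse n f) ⟩
  prodFin n (λ i → f (n ∸ suc (toℕ i))) * f n
    ≡⟨ *-comm _ (f n) ⟩
  f n * prodFin n (λ i → f (n ∸ suc (toℕ i)))
    ∎

altSum-cong : ∀ n {f g : Fin (suc n) → ℤ} → (∀ i → f i ≡ g i) → altSum n f ≡ altSum n g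
altSum-cong zero    f≗g = f≗g zero
altSum-cong (suc n) f≗g = cong₂ (λ a b → a + - b) (f≗g zero) (altSum-cong n (f≗g ∘ suc))

altSum-linear : ∀ n (f g : Fin (suc n) → ℤ) s →
                altSum n (λ i → f i + s * g i) ≡ altSum n f + s * altSum n g
altSum-linear zero    f g s = refl
altSum-linear (suc n) f g s =
  trans (cong (λ u → f zero + s * g zero + - u) (altSum-linear n (f ∘ suc) (g ∘ suc) s))
        (regroup (f zero) (g zero) s (altSum n (f ∘ suc)) (altSum n (g ∘ suc)))
  where
  regroup : ∀ a b s c d → a + s * b + - (c + s * d) ≡ a + - c + s * (b + - d)
  regroup = solve-∀

altSum-scale : ∀ n (f : Fin (suc n) → ℤ) s → altSum n (λ i → s * f i) ≡ s * altSum n f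
altSum-scale zero    f s = refl
altSum-scale (suc n) f s =
  trans (cong (λ u → s * f zero + - u) (altSum-scale n (f ∘ suc) s))
        (factor s (f zero) (altSum n (f ∘ suc)))
  where
  factor : ∀ s a b → s * a + - (s * b) ≡ s * (a + - b)
  factor = solve-∀

altSum-0 : ∀ n (f : Fin (suc n) → ℤ) → (∀ i → f i ≡ + 0) → altSum n f ≡ + 0
altSum-0 zero    f f≡0 = f≡0 zero
altSum-0 (suc n) f f≡0 = cong₂ (λ a b → a + - b) (f≡0 zero) (altSum-0 n (f ∘ suc) (f≡0 ∘ suc))

altSum-adjacent-cancel : ∀ n (f : Fin (suc n) → ℤ) (a : Fin n) → f (inject₁ a) ≡ f (suc a) →
                         (∀ j → j ≢ inject₁ a → j ≢ suc a → f j ≡ + 0) → altSum n f ≡ + 0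
altSum-adjacent-cancel (suc zero) f zero f₀≡f₁ _ =
  trans (cong (λ u → u + - f (suc zero)) f₀≡f₁) (+-inverseʳ (f (suc zero)))
altSum-adjacent-cancel (suc (suc n)) f zero f₀≡f₁ rest≡0 =
  trans (cong₂ (λ u v → u + - (f (suc zero) + - v)) f₀≡f₁ rest-sum≡0) (x-[x-0]≡0 (f (suc zero)))
  where
  rest-sum≡0 : altSum n (λ i → f (suc (suc i))) ≡ + 0
  rest-sum≡0 = altSum-0 n (λ i → f (suc (suc i))) (λ i → rest≡0 (suc (suc i)) (λ ()) (λ ()))
  x-[x-0]≡0 : ∀ x → x + - (x + - + 0) ≡ + 0
  x-[x-0]≡0 = solve-∀
altSum-adjacent-cancel (suc n) f (suc a) fa≡fa+1 rest≡0 =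
  cong₂ (λ u v → u + - v) (rest≡0 zero (λ ()) (λ ()))
        (altSum-adjacent-cancel n (f ∘ suc) a fa≡fa+1
          (λ j j≢a j≢a+1 → rest≡0 (suc j) (j≢a ∘ Finₚ.suc-injective) (j≢a+1 ∘ Finₚ.suc-injective)))

altSum-last : ∀ n (f : Fin (suc n) → ℤ) → (∀ j → toℕ j < n → f j ≡ + 0) →
              altSum n f ≡ -1ℤ ^ n * f (fromℕ n)
altSum-last zero    f _     = sym (*-identityˡ _)
altSum-last (suc n) f f≡0 =
  trans (cong₂ (λ u v → u + - v) (f≡0 zero (ℕ.s≤s ℕ.z≤n))
                                 (altSum-last n (f ∘ suc) (λ j j<n → f≡0 (suc j) (ℕ.s≤s j<n))))
        (0-xy≡-1xy (-1ℤ ^ n) (f (fromℕ (suc n))))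
  where
  0-xy≡-1xy : ∀ x y → + 0 + - (x * y) ≡ - + 1 * x * y
  0-xy≡-1xy = solve-∀

-1^n*prodFin[a-b]≡prodFin[b-a] : ∀ n (a : Fin n → ℤ) b →
                                 -1ℤ ^ n * prodFin n (λ i → a i - b) ≡ prodFin n (λ i → b - a i)
-1^n*prodFin[a-b]≡prodFin[b-a] zero    a b = refl
-1^n*prodFin[a-b]≡prodFin[b-a] (suc n) a b =
  trans (swap (-1ℤ ^ n) (a zero) b _) (cong ((b - a zero) *_) (-1^n*prodFin[a-b]≡prodFin[b-a] n (a ∘ suc) b))
  where
  swap : ∀ s a b p → - + 1 * s * ((a - b) * p) ≡ (b - a) * (s * p)
  swap = solve-∀

Matrix : ℕ → Set
Matrix n = Fin n → Fin n → ℤ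

minor : ∀ {n} → Matrix (suc n) → Fin (suc n) → Matrix n
minor M j r c = M (suc r) (punchIn j c)

det-cong : ∀ n {M N : Matrix n} → (∀ r c → M r c ≡ N r c) → det n M ≡ det n N
det-cong zero    M≗N = refl
det-cong (suc n) M≗N =
  altSum-cong n (λ j → cong₂ _*_ (M≗N zero j) (det-cong n (λ r c → M≗N (suc r) (punchIn j c))))

det-scale-rows : ∀ n (s : Fin n → ℤ) M → det n (λ r c → s r * M r c) ≡ prodFin n s * det n M
det-scale-rows zero    s M = refl
det-scale-rows (suc n) s M =
  trans (altSum-cong n (λ j → trans (cong (s zero * M zero j *_) (det-scale-rows n (s ∘ suc) (minor M j)))
                                    (interchange (s zero) (M zero j) _ _)))
        (altSum-scale n (λ j → M zero j * det n (minor M j)) (s zero * prodFin n (s ∘ suc)))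

det-scale-cols : ∀ n (t : Fin n → ℤ) M → det n (λ r c → M r c * t c) ≡ prodFin n t * det n M
det-scale-cols zero    t M = refl
det-scale-cols (suc n) t M =
  trans (altSum-cong n term) (altSum-scale n (λ j → M zero j * det n (minor M j)) (prodFin (suc n) t))
  where
  term : ∀ j → M zero j * t j * det n (λ r c → minor M j r c * t (punchIn j c))
             ≡ prodFin (suc n) t * (M zero j * det n (minor M j))
  term j = begin
    M zero j * t j * det n (λ r c → minor M j r c * t (punchIn j c))
      ≡⟨ cong (M zero j * t j *_) (det-scale-cols n (t ∘ punchIn j) (minor M j)) ⟩
    M zero j * t j * (prodFin n (t ∘ punchIn j) * det n (minor M j))
      ≡⟨ rearrange (M zero j) (t j) _ _ ⟩
    (t j * prodFin n (t ∘ punchIn j)) * (M zero j * det n (minor M j))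
      ≡⟨ cong (_* (M zero j * det n (minor M j))) (prodFin-punchIn n t j) ⟩
    prodFin (suc n) t * (M zero j * det n (minor M j))
      ∎
    where
    rearrange : ∀ m t p d → m * t * (p * d) ≡ t * p * (m * d)
    rearrange = solve-∀

det-linear-col : ∀ n (a : Fin n) (M N P : Matrix n) s →
                 (∀ r c → c ≢ a → M r c ≡ N r c) → (∀ r c → c ≢ a → M r c ≡ P r c) →
                 (∀ r → M r a ≡ N r a + s * P r a) → det n M ≡ det n N + s * det n P
det-linear-col (suc n) a M N P s M≡N M≡P Ma≡Na+sPa =
  trans (altSum-cong n term)
        (altSum-linear n (λ j → N zero j * det n (minor N j)) (λ j → P zero j * det n (minor P j)) s)
  where
  term : ∀ j → M zero j * det n (minor M j) ≡ N zero j * det n (minor N j) + s * (P zero j * det n (minor P j))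
  term j with j ≟ a
  ... | yes refl = begin
    M zero j * det n (minor M j)
      ≡⟨ cong (_* det n (minor M j)) (Ma≡Na+sPa zero) ⟩
    (N zero j + s * P zero j) * det n (minor M j)
      ≡⟨ distribʳ (N zero j) s (P zero j) (det n (minor M j)) ⟩
    N zero j * det n (minor M j) + s * (P zero j * det n (minor M j))
      ≡⟨ cong₂ (λ u v → N zero j * u + s * (P zero j * v))
               (det-cong n (λ r c → M≡N (suc r) (punchIn j c) (Finₚ.punchInᵢ≢i j c)))
               (det-cong n (λ r c → M≡P (suc r) (punchIn j c) (Finₚ.punchInᵢ≢i j c))) ⟩
    N zero j * det n (minor N j) + s * (P zero j * det n (minor P j))
      ∎
    where
    distribʳ : ∀ a s b d → (a + s * b) * d ≡ a * d + s * (b * d)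
    distribʳ = solve-∀
  ... | no j≢a = begin
    M zero j * det n (minor M j)
      ≡⟨ cong (M zero j *_) minor-linear ⟩
    M zero j * (det n (minor N j) + s * det n (minor P j))
      ≡⟨ distribˡ (M zero j) s (det n (minor N j)) (det n (minor P j)) ⟩
    M zero j * det n (minor N j) + s * (M zero j * det n (minor P j))
      ≡⟨ cong₂ (λ u v → u * det n (minor N j) + s * (v * det n (minor P j)))
               (M≡N zero j j≢a) (M≡P zero j j≢a) ⟩
    N zero j * det n (minor N j) + s * (P zero j * det n (minor P j))
      ∎
    where
    distribˡ : ∀ m s x y → m * (x + s * y) ≡ m * x + s * (m * y)
    distribˡ = solve-∀
    a′ : Fin n
    a′ = punchOut j≢a
    punchIn-a′ : punchIn j a′ ≡ a
    punchIn-a′ = Finₚ.punchIn-punchOut j≢a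
    punchIn-≢a : ∀ c → c ≢ a′ → punchIn j c ≢ a
    punchIn-≢a c c≢a′ eq = c≢a′ (Finₚ.punchIn-injective j c a′ (trans eq (sym punchIn-a′)))
    minor-linear : det n (minor M j) ≡ det n (minor N j) + s * det n (minor P j)
    minor-linear = det-linear-col n a′ (minor M j) (minor N j) (minor P j) s
      (λ r c c≢a′ → M≡N (suc r) (punchIn j c) (punchIn-≢a c c≢a′))
      (λ r c c≢a′ → M≡P (suc r) (punchIn j c) (punchIn-≢a c c≢a′))
      (λ r → subst (λ c → M (suc r) c ≡ N (suc r) c + s * P (suc r) c) (sym punchIn-a′) (Ma≡Na+sPa (suc r)))

punchIn-adjacent : ∀ {n} (a c : Fin n) →
                   punchIn (inject₁ a) c ≡ punchIn (suc a) c
                   ⊎ (punchIn (inject₁ a) c ≡ suc a × punchIn (suc a) c ≡ inject₁ a)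
punchIn-adjacent zero    zero    = inj₂ (refl , refl)
punchIn-adjacent zero    (suc c) = inj₁ refl
punchIn-adjacent (suc a) zero    = inj₁ refl
punchIn-adjacent (suc a) (suc c) with punchIn-adjacent a c
... | inj₁ eq          = inj₁ (cong suc eq)
... | inj₂ (eq₁ , eq₂) = inj₂ (cong suc eq₁ , cong suc eq₂)

punchIn-adjacent-preimage : ∀ {n} (a : Fin (suc n)) (j : Fin (suc (suc n))) →
                            j ≢ inject₁ a → j ≢ suc a →
                            Σ[ a′ ∈ Fin n ] punchIn j (inject₁ a′) ≡ inject₁ a
                                          × punchIn j (suc a′) ≡ suc a
punchIn-adjacent-preimage         zero    zero          j≢a _     = ⊥-elim (j≢a refl)
punchIn-adjacent-preimage         (suc a) zero          _   _     = a , refl , refl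
punchIn-adjacent-preimage         zero    (suc zero)    _   j≢a+1 = ⊥-elim (j≢a+1 refl)
punchIn-adjacent-preimage {suc n} zero    (suc (suc j)) _   _     = zero , refl , refl
punchIn-adjacent-preimage {suc n} (suc a) (suc j) j≢a j≢a+1
  with punchIn-adjacent-preimage a j (j≢a ∘ cong suc) (j≢a+1 ∘ cong suc)
... | a′ , eq₁ , eq₂ = suc a′ , cong suc eq₁ , cong suc eq₂

-- Expanding along the first row: the terms at columns a and a + 1 cancel, all others
-- vanish by induction since their minors still have two equal adjacent columns.
det-adjacent-equal-cols : ∀ n (M : Matrix (suc n)) (a : Fin n) →
                          (∀ r → M r (inject₁ a) ≡ M r (suc a)) → det (suc n) M ≡ + 0
det-adjacent-equal-cols (suc n) M a Ma≡Ma+1 =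
  altSum-adjacent-cancel (suc n) (λ j → M zero j * det (suc n) (minor M j)) a
    (cong₂ _*_ (Ma≡Ma+1 zero) (det-cong (suc n) adjacent-minors-equal)) other-terms-vanish
  where
  adjacent-minors-equal : ∀ r c → minor M (inject₁ a) r c ≡ minor M (suc a) r c
  adjacent-minors-equal r c with punchIn-adjacent a c
  ... | inj₁ eq          = cong (M (suc r)) eq
  ... | inj₂ (eq₁ , eq₂) =
    trans (cong (M (suc r)) eq₁) (trans (sym (Ma≡Ma+1 (suc r))) (cong (M (suc r)) (sym eq₂)))
  other-terms-vanish : ∀ j → j ≢ inject₁ a → j ≢ suc a → M zero j * det (suc n) (minor M j) ≡ + 0
  other-terms-vanish j j≢a j≢a+1 with punchIn-adjacent-preimage a j j≢a j≢a+1
  ... | a′ , eq₁ , eq₂ =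
    trans (cong (M zero j *_) (det-adjacent-equal-cols n (minor M j) a′ minor-cols-equal))
          (*-zeroʳ (M zero j))
    where
    minor-cols-equal : ∀ r → minor M j r (inject₁ a′) ≡ minor M j r (suc a′)
    minor-cols-equal r =
      trans (cong (M (suc r)) eq₁) (trans (Ma≡Ma+1 (suc r)) (cong (M (suc r)) (sym eq₂)))

det-add-adjacent-col : ∀ n (a : Fin n) (M M′ : Matrix (suc n)) t →
                       (∀ r c → c ≢ inject₁ a → M′ r c ≡ M r c) →
                       (∀ r → M′ r (inject₁ a) ≡ M r (inject₁ a) + t * M r (suc a)) →
                       det (suc n) M′ ≡ det (suc n) M
det-add-adjacent-col n a M M′ t M′≡M M′a≡Ma+tMa+1 = begin
  det (suc n) M′
    ≡⟨ det-linear-col (suc n) (inject₁ a) M′ M P t M′≡M M′≡P M′a≡Ma+tPa ⟩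
  det (suc n) M + t * det (suc n) P
    ≡⟨ cong (λ d → det (suc n) M + t * d) (det-adjacent-equal-cols n P a Pa≡Pa+1) ⟩
  det (suc n) M + t * + 0
    ≡⟨ x+y*0≡x (det (suc n) M) t ⟩
  det (suc n) M
    ∎
  where
  x+y*0≡x : ∀ x y → x + y * + 0 ≡ x
  x+y*0≡x = solve-∀
  P : Matrix (suc n)
  P r = updateAt (M r) (inject₁ a) (λ _ → M r (suc a))
  suc≢inject₁ : suc a ≢ inject₁ a
  suc≢inject₁ eq = ℕₚ.1+n≢n (trans (cong toℕ eq) (Finₚ.toℕ-inject₁ a))
  M′≡P : ∀ r c → c ≢ inject₁ a → M′ r c ≡ P r c
  M′≡P r c c≢a = trans (M′≡M r c c≢a) (sym (updateAt-minimal c (inject₁ a) (M r) c≢a))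
  M′a≡Ma+tPa : ∀ r → M′ r (inject₁ a) ≡ M r (inject₁ a) + t * P r (inject₁ a)
  M′a≡Ma+tPa r = trans (M′a≡Ma+tMa+1 r)
                       (cong (λ x → M r (inject₁ a) + t * x) (sym (updateAt-updates (inject₁ a) (M r))))
  Pa≡Pa+1 : ∀ r → P r (inject₁ a) ≡ P r (suc a)
  Pa≡Pa+1 r = trans (updateAt-updates (inject₁ a) (M r))
                    (sym (updateAt-minimal (suc a) (inject₁ a) (M r) suc≢inject₁))

ff-+ : ∀ x a b → ff x (a ℕ.+ b) ≡ ff x a * ff (x - + a) b
ff-+ x zero    b = trans (cong (λ w → ff w b) (sym (+-identityʳ x))) (sym (*-identityˡ _))
ff-+ x (suc a) b = begin
  x * ff (x - + 1) (a ℕ.+ b)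
    ≡⟨ cong (x *_) (ff-+ (x - + 1) a b) ⟩
  x * (ff (x - + 1) a * ff (x - + 1 - + a) b)
    ≡⟨ x∙yz≈xy∙z x _ _ ⟩
  x * ff (x - + 1) a * ff (x - + 1 - + a) b
    ≡⟨ cong (λ w → x * ff (x - + 1) a * ff w b) (x-1-a≡x-[1+a] x (+ a)) ⟩
  x * ff (x - + 1) a * ff (x - + suc a) b
    ∎
  where
  x-1-a≡x-[1+a] : ∀ x a → x - + 1 - a ≡ x - (+ 1 + a)
  x-1-a≡x-[1+a] = solve-∀

ff-sucʳ : ∀ x q → ff x (suc q) ≡ ff x q * (x - + q)
ff-sucʳ x q = begin
  ff x (suc q)                  ≡⟨ cong (ff x) (ℕₚ.+-comm 1 q) ⟩
  ff x (q ℕ.+ 1)                ≡⟨ ff-+ x q 1 ⟩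
  ff x q * ((x - + q) * + 1)    ≡⟨ cong (ff x q *_) (*-identityʳ (x - + q)) ⟩
  ff x q * (x - + q)            ∎

ff-*-[x-a] : ∀ x a q → ff x q * (x - a) ≡ ff x (suc q) + - (a - + q) * ff x q
ff-*-[x-a] x a q =
  trans (split (ff x q) x a (+ q)) (cong (_+ - (a - + q) * ff x q) (sym (ff-sucʳ x q)))
  where
  split : ∀ f x a q → f * (x - a) ≡ f * (x - q) + - (a - q) * f
  split = solve-∀

ff-exchange : ∀ x a b → ff (x - + b) a * ff x b ≡ ff x a * ff (x - + a) b
ff-exchange x a b = begin
  ff (x - + b) a * ff x b   ≡⟨ *-comm (ff (x - + b) a) (ff x b) ⟩
  ff x b * ff (x - + b) a   ≡⟨ ff-+ x b a ⟨
  ff x (b ℕ.+ a)            ≡⟨ cong (ff x) (ℕₚ.+-comm b a) ⟩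
  ff x (a ℕ.+ b)            ≡⟨ ff-+ x a b ⟩
  ff x a * ff (x - + a) b   ∎

vandermonde : (n : ℕ) → (Fin n → ℤ) → ℤ
vandermonde zero    z = + 1
vandermonde (suc n) z = prodFin n (λ i → z zero - z (suc i)) * vandermonde n (z ∘ suc)

ffVandermonde : ∀ n → (Fin (suc n) → ℤ) → Matrix (suc n)
ffVandermonde n z r c = ff (z r) (n ∸ toℕ c)

-- By ff-*-[x-a], column c is column c of ffVandermonde minus (z zero - (n - c - 1)) times
-- column c + 1; it vanishes in row zero.
reducedColumns : ∀ n → (Fin (suc n) → ℤ) → Matrix (suc n)
reducedColumns n z r c = ff (z r) (n ∸ suc (toℕ c)) * (z r - z zero)

partiallyReduced : ∀ n → (Fin (suc n) → ℤ) → ℕ → Matrix (suc n)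
partiallyReduced n z k r c = if does (toℕ c <? k) then reducedColumns n z r c else ffVandermonde n z r c

if-< : ∀ {A : Set} {m n} (x y : A) → m < n → (if does (m <? n) then x else y) ≡ x
if-< x y m<n = cong (λ b → if b then x else y) (dec-true (_ <? _) m<n)

if-≮ : ∀ {A : Set} {m n} (x y : A) → ¬ m < n → (if does (m <? n) then x else y) ≡ y
if-≮ x y m≮n = cong (λ b → if b then x else y) (dec-false (_ <? _) m≮n)

partiallyReduced-step : ∀ n z k → k < n →
  det (suc n) (partiallyReduced n z (suc k)) ≡ det (suc n) (partiallyReduced n z k)
partiallyReduced-step n z k k<n =
  det-add-adjacent-col n a (partiallyReduced n z k) (partiallyReduced n z (suc k)) t unchanged reduced
  where
  a : Fin n
  a = fromℕ< k<n
  toℕ-a : toℕ (inject₁ a) ≡ k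
  toℕ-a = trans (Finₚ.toℕ-inject₁ a) (Finₚ.toℕ-fromℕ< k<n)
  toℕ-a+1 : toℕ (suc a) ≡ suc k
  toℕ-a+1 = cong suc (Finₚ.toℕ-fromℕ< k<n)
  q : ℕ
  q = n ∸ suc k
  t : ℤ
  t = - (z zero - + q)
  unchanged : ∀ r c → c ≢ inject₁ a → partiallyReduced n z (suc k) r c ≡ partiallyReduced n z k r c
  unchanged r c c≢a with toℕ c <? k
  ... | yes c<k = trans (if-< _ _ (ℕₚ.m≤n⇒m≤1+n c<k)) (sym (if-< _ _ c<k))
  ... | no  c≮k = trans (if-≮ _ _ c≮1+k) (sym (if-≮ _ _ c≮k))
    where
    c≮1+k : ¬ toℕ c < suc k
    c≮1+k c<1+k =
      c≢a (Finₚ.toℕ-injective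
            (trans (ℕₚ.≤-antisym (ℕₚ.≤-pred c<1+k) (ℕₚ.≮⇒≥ c≮k)) (sym toℕ-a)))
  reduced : ∀ r → partiallyReduced n z (suc k) r (inject₁ a)
                  ≡ partiallyReduced n z k r (inject₁ a) + t * partiallyReduced n z k r (suc a)
  reduced r = begin
    partiallyReduced n z (suc k) r (inject₁ a)
      ≡⟨ if-< _ _ (ℕₚ.≤-reflexive (cong suc toℕ-a)) ⟩
    ff (z r) (n ∸ suc (toℕ (inject₁ a))) * (z r - z zero)
      ≡⟨ cong (λ i → ff (z r) (n ∸ suc i) * (z r - z zero)) toℕ-a ⟩
    ff (z r) q * (z r - z zero)
      ≡⟨ ff-*-[x-a] (z r) (z zero) q ⟩
    ff (z r) (suc q) + t * ff (z r) q
      ≡⟨ cong₂ (λ i j → ff (z r) i + t * ff (z r) j)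
               (trans (cong (n ∸_) toℕ-a) (ℕₚ.+-∸-assoc 1 k<n)) (cong (n ∸_) toℕ-a+1) ⟨
    ffVandermonde n z r (inject₁ a) + t * ffVandermonde n z r (suc a)
      ≡⟨ cong₂ (λ u v → u + t * v)
               (if-≮ _ _ (ℕₚ.≤⇒≯ (ℕₚ.≤-reflexive (sym toℕ-a))))
               (if-≮ _ _ (ℕₚ.≤⇒≯ (ℕₚ.≤-trans (ℕₚ.n≤1+n k) (ℕₚ.≤-reflexive (sym toℕ-a+1))))) ⟨
    partiallyReduced n z k r (inject₁ a) + t * partiallyReduced n z k r (suc a)
      ∎

det-partiallyReduced : ∀ n z k → k ≤ n →
                       det (suc n) (partiallyReduced n z k) ≡ det (suc n) (ffVandermonde n z)
det-partiallyReduced n z zero    _   = refl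
det-partiallyReduced n z (suc k) k<n =
  trans (partiallyReduced-step n z k k<n) (det-partiallyReduced n z k (ℕₚ.<⇒≤ k<n))

punchIn-fromℕ : ∀ {n} (c : Fin n) → punchIn (fromℕ n) c ≡ inject₁ c
punchIn-fromℕ zero    = refl
punchIn-fromℕ (suc c) = cong suc (punchIn-fromℕ c)

-- Once every column but the last is reduced, the first row is (0, …, 0, 1), and the minor of
-- its last entry is ffVandermonde for z ∘ suc with row r scaled by z (suc r) - z zero.
det-ffVandermonde : ∀ n z → det (suc n) (ffVandermonde n z) ≡ vandermonde (suc n) z
det-ffVandermonde zero    z = refl
det-ffVandermonde (suc n) z = begin
  det (suc m) (ffVandermonde m z)
    ≡⟨ det-partiallyReduced m z m ℕₚ.≤-refl ⟨
  det (suc m) R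
    ≡⟨ altSum-last m (λ j → R zero j * det m (minor R j)) first-row-vanishes ⟩
  -1ℤ ^ m * (R zero (fromℕ m) * det m (minor R (fromℕ m)))
    ≡⟨ cong₂ (λ u v → -1ℤ ^ m * (u * v)) corner≡1 last-minor ⟩
  -1ℤ ^ m * (+ 1 * (prodFin m s * vandermonde m (z ∘ suc)))
    ≡⟨ regroup (-1ℤ ^ m) (prodFin m s) (vandermonde m (z ∘ suc)) ⟩
  -1ℤ ^ m * prodFin m s * vandermonde m (z ∘ suc)
    ≡⟨ cong (_* vandermonde m (z ∘ suc)) (-1^n*prodFin[a-b]≡prodFin[b-a] m (z ∘ suc) (z zero)) ⟩
  vandermonde (suc m) z
    ∎
  where
  m = suc n
  R : Matrix (suc m)
  R = partiallyReduced m z m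
  s : Fin m → ℤ
  s r = z (suc r) - z zero
  regroup : ∀ a p v → a * (+ 1 * (p * v)) ≡ a * p * v
  regroup = solve-∀
  first-row-vanishes : ∀ j → toℕ j < m → R zero j * det m (minor R j) ≡ + 0
  first-row-vanishes j j<m =
    trans (cong (_* det m (minor R j)) (if-< _ _ j<m))
          (x[y-y]z≡0 (ff (z zero) (n ∸ toℕ j)) (z zero) (det m (minor R j)))
    where
    x[y-y]z≡0 : ∀ x y w → x * (y - y) * w ≡ + 0
    x[y-y]z≡0 = solve-∀
  corner≡1 : R zero (fromℕ m) ≡ + 1
  corner≡1 = begin
    R zero (fromℕ m)
      ≡⟨ if-≮ _ _ (ℕₚ.≤⇒≯ (ℕₚ.≤-reflexive (sym (Finₚ.toℕ-fromℕ m)))) ⟩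
    ff (z zero) (m ∸ toℕ (fromℕ m))
      ≡⟨ cong (λ i → ff (z zero) (m ∸ i)) (Finₚ.toℕ-fromℕ m) ⟩
    ff (z zero) (m ∸ m)
      ≡⟨ cong (ff (z zero)) (ℕₚ.n∸n≡0 m) ⟩
    + 1
      ∎
  minor-entry : ∀ r c → minor R (fromℕ m) r c ≡ s r * ffVandermonde n (z ∘ suc) r c
  minor-entry r c = begin
    R (suc r) (punchIn (fromℕ m) c)
      ≡⟨ cong (R (suc r)) (punchIn-fromℕ c) ⟩
    R (suc r) (inject₁ c)
      ≡⟨ if-< _ _ (Finₚ.inject₁ℕ< c) ⟩
    ff (z (suc r)) (n ∸ toℕ (inject₁ c)) * s r
      ≡⟨ cong (λ i → ff (z (suc r)) (n ∸ i) * s r) (Finₚ.toℕ-inject₁ c) ⟩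
    ff (z (suc r)) (n ∸ toℕ c) * s r
      ≡⟨ *-comm _ (s r) ⟩
    s r * ffVandermonde n (z ∘ suc) r c
      ∎
  last-minor : det m (minor R (fromℕ m)) ≡ prodFin m s * vandermonde m (z ∘ suc)
  last-minor = begin
    det m (minor R (fromℕ m))
      ≡⟨ det-cong m minor-entry ⟩
    det m (λ r c → s r * ffVandermonde n (z ∘ suc) r c)
      ≡⟨ det-scale-rows m s (ffVandermonde n (z ∘ suc)) ⟩
    prodFin m s * det m (ffVandermonde n (z ∘ suc))
      ≡⟨ cong (prodFin m s *_) (det-ffVandermonde n (z ∘ suc)) ⟩
    prodFin m s * vandermonde m (z ∘ suc)
      ∎

detPoly : ∀ {N} n → (Fin n → Fin n → Poly N) → Poly N
detPoly = Det.det pone padd pmul pneg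

altSumPoly : ∀ {N} n → (Fin (suc n) → Poly N) → Poly N
altSumPoly = Det.altSum pone padd pmul pneg

FreeOf : ∀ {N} → Fin N → Poly N → Set
FreeOf j = All (λ (_ , e) → e j ≡ 0)

module _ {N : ℕ} {j : Fin N} where

  freeOf-pneg : ∀ {p} → FreeOf j p → FreeOf j (pneg p)
  freeOf-pneg = map⁺

  freeOf-pmul : ∀ {p q} → FreeOf j p → FreeOf j q → FreeOf j (pmul p q)
  freeOf-pmul p-free q-free =
    concat⁺ (map⁺ (All.map (λ e≡0 → map⁺ (All.map (λ f≡0 → cong₂ ℕ._+_ e≡0 f≡0) q-free)) p-free))

  freeOf-xpow : ∀ i k → i ≢ j → FreeOf j (xpow i k)
  freeOf-xpow i k i≢j = cong (λ b → if b then k else 0) (dec-false (j ≟ i) (i≢j ∘ sym)) ∷ []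

  freeOf-altSumPoly : ∀ n (f : Fin (suc n) → Poly N) → (∀ i → FreeOf j (f i)) → FreeOf j (altSumPoly n f)
  freeOf-altSumPoly zero    f f-free = f-free zero
  freeOf-altSumPoly (suc n) f f-free =
    ++⁺ (f-free zero) (freeOf-pneg (freeOf-altSumPoly n (f ∘ suc) (f-free ∘ suc)))

  freeOf-detPoly-xpow : ∀ n (σ : Fin n → Fin N) (k : Fin n → ℕ) → (∀ c → σ c ≢ j) →
                        FreeOf j (detPoly n (λ r c → xpow (σ c) (k r)))
  freeOf-detPoly-xpow zero    σ k σ≢j = refl ∷ []
  freeOf-detPoly-xpow (suc n) σ k σ≢j =
    freeOf-altSumPoly n _ (λ i → freeOf-pmul (freeOf-xpow (σ i) (k zero) (σ≢j i))
                                 (freeOf-detPoly-xpow n (σ ∘ punchIn i) (k ∘ suc) (σ≢j ∘ punchIn i)))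

module _ {N : ℕ} (y : Fin N → ℤ) where

  star-padd : (p q : Poly N) → star (padd p q) y ≡ star p y + star q y
  star-padd []            q = sym (+-identityˡ (star q y))
  star-padd ((c , e) ∷ p) q =
    trans (cong (λ s → c * prodFin N (λ i → ff (y i) (e i)) + s) (star-padd p q))
          (sym (+-assoc (c * prodFin N (λ i → ff (y i) (e i))) (star p y) (star q y)))

  star-pneg : (p : Poly N) → star (pneg p) y ≡ - star p y
  star-pneg []            = refl
  star-pneg ((c , e) ∷ p) =
    trans (cong (λ s → - c * prodFin N (λ i → ff (y i) (e i)) + s) (star-pneg p))
          (neg-distrib c (prodFin N (λ i → ff (y i) (e i))) (star p y))
    where
    neg-distrib : ∀ c P s → - c * P + - s ≡ - (c * P + s)
    neg-distrib = solve-∀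

  star-altSumPoly : ∀ n (f : Fin (suc n) → Poly N) → star (altSumPoly n f) y ≡ altSum n (λ i → star (f i) y)
  star-altSumPoly zero    f = refl
  star-altSumPoly (suc n) f =
    trans (star-padd (f zero) (pneg (altSumPoly n (f ∘ suc))))
          (cong (λ s → star (f zero) y + s) (trans (star-pneg (altSumPoly n (f ∘ suc)))
                                            (cong -_ (star-altSumPoly n (f ∘ suc)))))

  prodFin-ff-xpow : ∀ j k (e : Fin N → ℕ) → e j ≡ 0 →
                    prodFin N (λ i → ff (y i) ((if does (i ≟ j) then k else 0) ℕ.+ e i))
                    ≡ ff (y j) k * prodFin N (λ i → ff (y i) (e i))
  prodFin-ff-xpow j k e e-j≡0 = begin
    prodFin N (λ i → ff (y i) (xe i ℕ.+ e i))
      ≡⟨ prodFin-cong N split ⟩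
    prodFin N (λ i → ff (y i) (xe i) * ff (y i) (e i))
      ≡⟨ prodFin-* N _ _ ⟩
    prodFin N (λ i → ff (y i) (xe i)) * prodFin N (λ i → ff (y i) (e i))
      ≡⟨ cong (_* prodFin N (λ i → ff (y i) (e i))) (prodFin-concentrated N _ j away-from-j) ⟩
    ff (y j) (xe j) * prodFin N (λ i → ff (y i) (e i))
      ≡⟨ cong (λ b → ff (y j) (if b then k else 0) * prodFin N (λ i → ff (y i) (e i)))
              (dec-true (j ≟ j) refl) ⟩
    ff (y j) k * prodFin N (λ i → ff (y i) (e i))
      ∎
    where
    xe : Fin N → ℕ
    xe i = if does (i ≟ j) then k else 0
    split : ∀ i → ff (y i) (xe i ℕ.+ e i) ≡ ff (y i) (xe i) * ff (y i) (e i)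
    split i with i ≟ j
    ... | yes refl rewrite e-j≡0 = trans (cong (ff (y i)) (ℕₚ.+-identityʳ k)) (sym (*-identityʳ _))
    ... | no  _    = sym (*-identityˡ _)
    away-from-j : ∀ i → i ≢ j → ff (y i) (xe i) ≡ + 1
    away-from-j i i≢j = cong (λ b → ff (y i) (if b then k else 0)) (dec-false (i ≟ j) i≢j)

  star-pmul-xpow : ∀ j k q → FreeOf j q → star (pmul (xpow j k) q) y ≡ ff (y j) k * star q y
  star-pmul-xpow j k []            []               = sym (*-zeroʳ (ff (y j) k))
  star-pmul-xpow j k ((c , e) ∷ q) (e-j≡0 ∷ q-free) =
    trans (cong₂ (λ P S → + 1 * c * P + S) (prodFin-ff-xpow j k e e-j≡0) (star-pmul-xpow j k q q-free))
          (factor (ff (y j) k) c (prodFin N (λ i → ff (y i) (e i))) (star q y))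
    where
    factor : ∀ f c P S → + 1 * c * (f * P) + f * S ≡ f * (c * P + S)
    factor = solve-∀

  star-detPoly-xpow : ∀ n (σ : Fin n → Fin N) (k : Fin n → ℕ) → Injective _≡_ _≡_ σ →
                      star (detPoly n (λ r c → xpow (σ c) (k r))) y ≡ det n (λ r c → ff (y (σ c)) (k r))
  star-detPoly-xpow zero    σ k σ-inj = cong (λ P → + 1 * P + + 0) (prodFin-1 N)
  star-detPoly-xpow (suc n) σ k σ-inj =
    trans (star-altSumPoly n _) (altSum-cong n λ i →
      trans (star-pmul-xpow (σ i) (k zero) _
               (freeOf-detPoly-xpow n (σ ∘ punchIn i) (k ∘ suc) (λ c → Finₚ.punchInᵢ≢i i c ∘ σ-inj)))
            (cong (ff (y (σ i)) (k zero) *_)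
               (star-detPoly-xpow n (σ ∘ punchIn i) (k ∘ suc) (Finₚ.punchIn-injective i _ _ ∘ σ-inj))))

vdm-vandermonde : ∀ n (m : Fin n → ℕ) x → vdm n m ≡ vandermonde n (λ i → x - + m i)
vdm-vandermonde zero    m x = refl
vdm-vandermonde (suc n) m x = begin
  vdm (suc n) m
    ≡⟨ cong₂ _*_ (prodFin-1 (suc n)) (prodFin-* n _ _) ⟩
  + 1 * (prodFin n (λ i → + m (suc i) - + m zero) * vdm n (m ∘ suc))
    ≡⟨ *-identityˡ _ ⟩
  prodFin n (λ i → + m (suc i) - + m zero) * vdm n (m ∘ suc)
    ≡⟨ cong₂ _*_ (prodFin-cong n (λ i → shift x (+ m zero) (+ m (suc i)))) (vdm-vandermonde n (m ∘ suc) x) ⟩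
  vandermonde (suc n) (λ i → x - + m i)
    ∎
  where
  shift : ∀ x a b → b - a ≡ (x - a) - (x - b)
  shift = solve-∀

x-[1+n]+[1+c]≡x-[n∸c] : ∀ x n (c : Fin (suc n)) → x - + suc n + + suc (toℕ c) ≡ x - + (n ∸ toℕ c)
x-[1+n]+[1+c]≡x-[n∸c] x n c =
  subst (λ n′ → x - + suc n′ + + suc (toℕ c) ≡ x - + (n ∸ toℕ c))
        (ℕₚ.m∸n+n≡m (Finₚ.toℕ≤pred[n] c)) (cancel x (+ (n ∸ toℕ c)) (+ toℕ c))
  where
  cancel : ∀ x b c → x - (+ 1 + (b + c)) + (+ 1 + c) ≡ x - b
  cancel = solve-∀

corollary2p1 : (n : ℕ) (m : Fin n → ℕ) (x : ℤ) →
    prodFin n (λ i → ff x (toℕ i)) * star (D n m) (λ j → x - + n + + suc (toℕ j))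
      ≡ vdm n m * prodFin n (λ i → ff x (m i))
corollary2p1 zero    m x = refl
corollary2p1 (suc n) m x = begin
  prodFin N (λ i → ff x (toℕ i)) * star (D N m) y
    ≡⟨ cong₂ _*_ (prodFin-reverse N (ff x)) (star-detPoly-xpow y N id m id) ⟩
  prodFin N t * det N (λ r c → ff (y c) (m r))
    ≡⟨ det-scale-cols N t (λ r c → ff (y c) (m r)) ⟨
  det N (λ r c → ff (y c) (m r) * t c)
    ≡⟨ det-cong N entry ⟩
  det N (λ r c → s r * ffVandermonde n z r c)
    ≡⟨ det-scale-rows N s (ffVandermonde n z) ⟩
  prodFin N s * det N (ffVandermonde n z)
    ≡⟨ cong (prodFin N s *_) (trans (det-ffVandermonde n z) (sym (vdm-vandermonde N m x))) ⟩
  prodFin N s * vdm N m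
    ≡⟨ *-comm (prodFin N s) (vdm N m) ⟩
  vdm N m * prodFin N s
    ∎
  where
  N = suc n
  y z : Fin N → ℤ
  y c = x - + N + + suc (toℕ c)
  z r = x - + m r
  s t : Fin N → ℤ
  s r = ff x (m r)
  t c = ff x (n ∸ toℕ c)
  entry : ∀ r c → ff (y c) (m r) * t c ≡ s r * ffVandermonde n z r c
  entry r c = trans (cong (λ w → ff w (m r) * t c) (x-[1+n]+[1+c]≡x-[n∸c] x n c))
                    (ff-exchange x (m r) (n ∸ toℕ c))
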